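{- If $G$ is a connected $P_4$-free graph of order $n\geq 4$, then $\gamma_{t[1,2]}(G)=2$ if $\Delta(G)=n-1$, and $\gamma_{t[1,2]}(G)=\gamma_{[1,2]}(G)=\gamma(G)$ if $\Delta(G)<n-1$.
   Context: All graphs are finite, simple and undirected; $N(v)$ is the neighborhood of $v$ and $\Delta(G)$ the maximum degree. A graph is $P_4$-free if it has no induced subgraph isomorphic to $P_4$. $\gamma(G)$ is the domination number (minimum size of a set $D$ such that every vertex not in $D$ has a neighbor in $D$). A set $S$ is a $[1,2]$-set if it satisfies $1\leq |N(v)\cap S|\leq 2$ for every $v\in V(G)\setminus S$; $\gamma_{[1,2]}(G)$ is the minimum size of a $[1,2]$-set. A set $S$ is a total $[1,2]$-set if $1\leq |N(v)\cap S|\leq 2$ for every $v\in V(G)$; $\gamma_{t[1,2]}(G)$ is the minimum size of a total $[1,2]$-set, with $\gamma_{t[1,2]}(G)=+\infty$ if none exists. -}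

module Defs where

open import Data.Nat using (ℕ; zero; suc; _≤_; _<_; _∸_; _⊔_)
open import Data.Bool using (Bool; true; false)
open import Data.Fin using (Fin)
open import Data.Fin.Subset using (Subset; _∈_; _∩_; ∣_∣)
open import Data.Vec using (tabulate)
open import Data.List using (foldr; map; allFin)
open import Data.Product using (Σ; _×_; ∃)
open import Relation.Binary.PropositionalEquality using (_≡_; _≢_)
open import Relation.Nullary using (¬_)

record Graph (n : ℕ) : Set where
  field
    adj     : Fin n → Fin n → Bool
    sym     : ∀ u v → adj u v ≡ adj v u
    irrefl  : ∀ v → adj v v ≡ false
open Graph public

module _ {n : ℕ} (G : Graph n) where

  N : Fin n → Subset n
  N v = tabulate (adj G v)

  deg : Fin n → ℕ
  deg v = ∣ N v ∣

  Δ : ℕ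
  Δ = foldr _⊔_ 0 (map deg (allFin n))

  data Reach : Fin n → Fin n → Set where
    here : ∀ {v} → Reach v v
    step : ∀ {u w v} → adj G u w ≡ true → Reach w v → Reach u v

  Connected : Set
  Connected = ∀ u v → Reach u v

  InducedP4 : Fin n → Fin n → Fin n → Fin n → Set
  InducedP4 a b c d =
    a ≢ b × a ≢ c × a ≢ d × b ≢ c × b ≢ d × c ≢ d ×
    adj G a b ≡ true × adj G b c ≡ true × adj G c d ≡ true ×
    adj G a c ≡ false × adj G b d ≡ false × adj G a d ≡ false

  P4Free : Set
  P4Free = ∀ a b c d → ¬ InducedP4 a b c d

  IsDominating : Subset n → Set
  IsDominating S = ∀ v → ¬ (v ∈ S) → 1 ≤ ∣ N v ∩ S ∣

  Is12Set : Subset n → Set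
  Is12Set S = ∀ v → ¬ (v ∈ S) → 1 ≤ ∣ N v ∩ S ∣ × ∣ N v ∩ S ∣ ≤ 2

  IsTotal12Set : Subset n → Set
  IsTotal12Set S = ∀ v → 1 ≤ ∣ N v ∩ S ∣ × ∣ N v ∩ S ∣ ≤ 2

-- "the minimum size of a set satisfying P equals k"
-- (a finite value; for γ_t[1,2] = +∞ no k satisfies this)
MinSizeIs : {n : ℕ} → (Subset n → Set) → ℕ → Set
MinSizeIs {n} P k = (Σ (Subset n) λ S → P S × ∣ S ∣ ≡ k) × (∀ S → P S → k ≤ ∣ S ∣)

γ≡ : {n : ℕ} → Graph n → ℕ → Set
γ≡ G = MinSizeIs (IsDominating G)

γ[1,2]≡ : {n : ℕ} → Graph n → ℕ → Set
γ[1,2]≡ G = MinSizeIs (Is12Set G)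

γt[1,2]≡ : {n : ℕ} → Graph n → ℕ → Set
γt[1,2]≡ G = MinSizeIs (IsTotal12Set G)

-- A connected P₄-free graph G on n ≥ 2 vertices always has two adjacent
-- vertices a, b such that every vertex is adjacent to a or to b: fix a and
-- move b among the neighbours of a; if some y is adjacent to neither, the
-- first vertex z adjacent to a on a walk from y to a has strictly more
-- neighbours outside N(a) than b, because any neighbour of b outside N(a)
-- that z missed would close an induced P₄. Such an edge {a, b} is a total
-- [1,2]-set of size 2, and 2 is also a lower bound for every total
-- [1,2]-set, and, when no vertex is universal, for every dominating set.
-- When there is a universal vertex v, {v, w} works for any w ≠ v.
module Submission where

open import Defs
open import Data.Nat using (ℕ; _≤_; _<_; _∸_)
open import Data.Product using (Σ; _×_)
open import Relation.Binary.PropositionalEquality using (_≡_)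

open import Data.Bool using (true; false)
import Data.Bool as Bool
open import Data.Empty using (⊥; ⊥-elim)
open import Function using (id; _∘_)
open import Data.Fin using (Fin; zero; suc; punchIn)
open import Data.Fin.Properties using (any?; punchInᵢ≢i) renaming (_≟_ to _≟ᶠ_)
open import Data.Fin.Subset
  using (Subset; _∈_; _∉_; _∩_; _∪_; ∁; ⁅_⁆; ∣_∣; _⊆_; _⊂_; Nonempty; inside; outside)
open import Data.Fin.Subset.Properties
open import Data.List using (allFin; map)
open import Data.List.Membership.Propositional.Properties
  using (∈-allFin; ∈-map⁺; ∈-map⁻; foldr-selective)
open import Data.List.Properties using (foldr-preservesᵒ)
import Data.List.Relation.Unary.Any as Any
open import Data.Nat using (suc; _+_; z≤n; s≤s)
open import Data.Nat.Induction using (<-wellFounded)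
open import Data.Nat.Properties
  using (≤-reflexive; ≤-trans; ≤-<-trans; <-irrefl; <⇒≢; ≤-antisym; n≤1+n; +-suc;
         +-monoʳ-≤; ⊔-sel; m≤n⇒m≤n⊔o; m≤n⇒m≤o⊔n; ∸-monoʳ-<)
open import Data.Product using (_,_; proj₁; ∃; ∃₂)
open import Data.Sum using (_⊎_; inj₁; inj₂; [_,_]′)
open import Data.Vec using (_∷_; []; here; there)
open import Data.Vec.Properties using (lookup∘tabulate; []=⇒lookup; lookup⇒[]=)
open import Induction.WellFounded using (Acc; acc)
open import Relation.Nullary using (Dec; yes; no; contradiction)
open import Relation.Nullary.Decidable using (_×-dec_; ¬?)
open import Relation.Binary.PropositionalEquality using (_≢_; refl; trans; cong; cong₂; subst)
import Relation.Binary.PropositionalEquality as ≡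

∣p∪q∣≤∣p∣+∣q∣ : ∀ {m} (p q : Subset m) → ∣ p ∪ q ∣ ≤ ∣ p ∣ + ∣ q ∣
∣p∪q∣≤∣p∣+∣q∣ []            []            = z≤n
∣p∪q∣≤∣p∣+∣q∣ (inside ∷ p)  (inside ∷ q)  =
  s≤s (≤-trans (∣p∪q∣≤∣p∣+∣q∣ p q) (+-monoʳ-≤ ∣ p ∣ (n≤1+n ∣ q ∣)))
∣p∪q∣≤∣p∣+∣q∣ (inside ∷ p)  (outside ∷ q) = s≤s (∣p∪q∣≤∣p∣+∣q∣ p q)
∣p∪q∣≤∣p∣+∣q∣ (outside ∷ p) (inside ∷ q)  =
  ≤-trans (s≤s (∣p∪q∣≤∣p∣+∣q∣ p q)) (≤-reflexive (≡.sym (+-suc ∣ p ∣ ∣ q ∣)))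
∣p∪q∣≤∣p∣+∣q∣ (outside ∷ p) (outside ∷ q) = ∣p∪q∣≤∣p∣+∣q∣ p q

1≤∣p∣⇒Nonempty : ∀ {m} {p : Subset m} → 1 ≤ ∣ p ∣ → Nonempty p
1≤∣p∣⇒Nonempty {p = inside ∷ p}  _      = zero , here
1≤∣p∣⇒Nonempty {p = outside ∷ p} 1≤∣p∣ with 1≤∣p∣⇒Nonempty 1≤∣p∣
... | x , x∈p = suc x , there x∈p

x∈p⇒⁅x⁆⊆p : ∀ {m} {x : Fin m} {p : Subset m} → x ∈ p → ⁅ x ⁆ ⊆ p
x∈p⇒⁅x⁆⊆p {x = x} {p} x∈p y∈⁅x⁆ = subst (_∈ p) (≡.sym (x∈⁅y⁆⇒x≡y x y∈⁅x⁆)) x∈p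

x∈p⇒1≤∣p∣ : ∀ {m} {x : Fin m} {p : Subset m} → x ∈ p → 1 ≤ ∣ p ∣
x∈p⇒1≤∣p∣ {x = x} {p} x∈p = subst (_≤ ∣ p ∣) (∣⁅x⁆∣≡1 x) (p⊆q⇒∣p∣≤∣q∣ (x∈p⇒⁅x⁆⊆p x∈p))

x≢y∈p⇒2≤∣p∣ : ∀ {m} {x y : Fin m} {p : Subset m} → x ∈ p → y ∈ p → x ≢ y → 2 ≤ ∣ p ∣
x≢y∈p⇒2≤∣p∣ {x = x} {y} {p} x∈p y∈p x≢y =
  subst (λ k → suc k ≤ ∣ p ∣) (∣⁅x⁆∣≡1 x) (p⊂q⇒∣p∣<∣q∣ ⁅x⁆⊂p)
  where
  ⁅x⁆⊂p : ⁅ x ⁆ ⊂ p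
  ⁅x⁆⊂p = x∈p⇒⁅x⁆⊆p x∈p , y , y∈p , λ y∈⁅x⁆ → x≢y (≡.sym (x∈⁅y⁆⇒x≡y x y∈⁅x⁆))

∣⁅x⁆∪⁅y⁆∣≡2 : ∀ {m} {x y : Fin m} → x ≢ y → ∣ ⁅ x ⁆ ∪ ⁅ y ⁆ ∣ ≡ 2
∣⁅x⁆∪⁅y⁆∣≡2 {x = x} {y} x≢y = ≤-antisym
  (≤-trans (∣p∪q∣≤∣p∣+∣q∣ ⁅ x ⁆ ⁅ y ⁆) (≤-reflexive (cong₂ _+_ (∣⁅x⁆∣≡1 x) (∣⁅x⁆∣≡1 y))))
  (x≢y∈p⇒2≤∣p∣ (x∈p∪q⁺ (inj₁ (x∈⁅x⁆ x))) (x∈p∪q⁺ (inj₂ (x∈⁅x⁆ y))) x≢y)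

MinSizeIs-sandwich : ∀ {m} {R P Q : Subset m → Set} {k : ℕ} →
  (∀ {S} → R S → P S) → (∀ {S} → P S → Q S) →
  (Σ (Subset m) λ S → R S × ∣ S ∣ ≡ k) → (∀ S → Q S → k ≤ ∣ S ∣) → MinSizeIs P k
MinSizeIs-sandwich R⇒P P⇒Q (S , RS , ∣S∣≡k) lowerBound =
  (S , R⇒P RS , ∣S∣≡k) , λ T PT → lowerBound T (P⇒Q PT)

module GraphProperties {n : ℕ} (G : Graph n) where

  infix 4 _~_ _≁_

  _~_ : Fin n → Fin n → Set
  u ~ v = adj G u v ≡ true

  _≁_ : Fin n → Fin n → Set
  u ≁ v = adj G u v ≡ false

  ~-sym : ∀ {u v} → u ~ v → v ~ u
  ~-sym {u} {v} u~v = trans (Graph.sym G v u) u~v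

  ≁-sym : ∀ {u v} → u ≁ v → v ≁ u
  ≁-sym {u} {v} u≁v = trans (Graph.sym G v u) u≁v

  ~⇒≁⇒⊥ : ∀ {u v} → u ~ v → u ≁ v → ⊥
  ~⇒≁⇒⊥ u~v u≁v with () ← trans (≡.sym u~v) u≁v

  ~⇒≢ : ∀ {u v} → u ~ v → u ≢ v
  ~⇒≢ {u} u~u refl = ~⇒≁⇒⊥ u~u (irrefl G u)

  ~-or-≁ : ∀ u v → u ~ v ⊎ u ≁ v
  ~-or-≁ u v with adj G u v
  ... | true  = inj₁ refl
  ... | false = inj₂ refl

  ≁? : ∀ u v → Dec (u ≁ v)
  ≁? u v = adj G u v Bool.≟ false

  ~⇒∈N : ∀ {u v} → u ~ v → v ∈ N G u
  ~⇒∈N {u} {v} u~v = lookup⇒[]= v (N G u) (trans (lookup∘tabulate (adj G u) v) u~v)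

  ∈N⇒~ : ∀ {u v} → v ∈ N G u → u ~ v
  ∈N⇒~ {u} {v} v∈N = trans (≡.sym (lookup∘tabulate (adj G u) v)) ([]=⇒lookup v∈N)

  ∉N⇒≁ : ∀ {u v} → v ∉ N G u → u ≁ v
  ∉N⇒≁ {u} {v} v∉N with ~-or-≁ u v
  ... | inj₁ u~v = contradiction (~⇒∈N u~v) v∉N
  ... | inj₂ u≁v = u≁v

  1≤∣N∩S∣⇒neighbourIn : ∀ {v S} → 1 ≤ ∣ N G v ∩ S ∣ → ∃ λ s → v ~ s × s ∈ S
  1≤∣N∩S∣⇒neighbourIn {v} {S} 1≤ with 1≤∣p∣⇒Nonempty 1≤
  ... | s , s∈N∩S with x∈p∩q⁻ (N G v) S s∈N∩S
  ... | s∈N , s∈S = s , ∈N⇒~ s∈N , s∈S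

  deg≤Δ : ∀ v → deg G v ≤ Δ G
  deg≤Δ v = foldr-preservesᵒ (λ x y → [ m≤n⇒m≤n⊔o y , m≤n⇒m≤o⊔n x ]′) 0 _
    (inj₂ (Any.map ≤-reflexive (∈-map⁺ (deg G) (∈-allFin v))))

  Δ-attained : 1 ≤ Δ G → ∃ λ v → deg G v ≡ Δ G
  Δ-attained 1≤Δ with foldr-selective ⊔-sel 0 (map (deg G) (allFin n))
  ... | inj₁ Δ≡0 = contradiction (subst (1 ≤_) Δ≡0 1≤Δ) λ ()
  ... | inj₂ Δ∈degs with ∈-map⁻ (deg G) Δ∈degs
  ... | v , _ , Δ≡deg = v , ≡.sym Δ≡deg

  N⊆∁⁅v⁆ : ∀ v → N G v ⊆ ∁ ⁅ v ⁆
  N⊆∁⁅v⁆ v u∈N = x∉p⇒x∈∁p λ u∈⁅v⁆ → ~⇒≢ (∈N⇒~ u∈N) (≡.sym (x∈⁅y⁆⇒x≡y v u∈⁅v⁆))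

  ∣∁⁅v⁆∣≡n∸1 : ∀ v → ∣ ∁ ⁅ v ⁆ ∣ ≡ n ∸ 1
  ∣∁⁅v⁆∣≡n∸1 v = trans (∣∁p∣≡n∸∣p∣ ⁅ v ⁆) (cong (n ∸_) (∣⁅x⁆∣≡1 v))

  deg≡n∸1⇒universal : ∀ {v} → deg G v ≡ n ∸ 1 → ∀ u → u ≢ v → v ~ u
  deg≡n∸1⇒universal {v} deg≡n∸1 u u≢v with ~-or-≁ v u
  ... | inj₁ v~u = v~u
  ... | inj₂ v≁u = contradiction (trans deg≡n∸1 (≡.sym (∣∁⁅v⁆∣≡n∸1 v))) (<⇒≢ (p⊂q⇒∣p∣<∣q∣ N⊂∁⁅v⁆))
    where
    N⊂∁⁅v⁆ : N G v ⊂ ∁ ⁅ v ⁆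
    N⊂∁⁅v⁆ = N⊆∁⁅v⁆ v , u , x∉p⇒x∈∁p (x≢y⇒x∉⁅y⁆ u≢v) , λ u∈N → ~⇒≁⇒⊥ (∈N⇒~ u∈N) v≁u

  Δ<n∸1⇒nonNeighbour : Δ G < n ∸ 1 → ∀ v → ∃ λ u → u ≢ v × v ≁ u
  Δ<n∸1⇒nonNeighbour Δ<n∸1 v with any? (λ u → ¬? (u ≟ᶠ v) ×-dec ≁? v u)
  ... | yes nonNeighbour = nonNeighbour
  ... | no noNonNeighbour = contradiction (≤-<-trans n∸1≤deg (≤-<-trans (deg≤Δ v) Δ<n∸1)) (<-irrefl refl)
    where
    ∁⁅v⁆⊆N : ∁ ⁅ v ⁆ ⊆ N G v
    ∁⁅v⁆⊆N {u} u∈∁⁅v⁆ with ~-or-≁ v u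
    ... | inj₁ v~u = ~⇒∈N v~u
    ... | inj₂ v≁u = contradiction (u , x∉⁅y⁆⇒x≢y (x∈∁p⇒x∉p u∈∁⁅v⁆) , v≁u) noNonNeighbour
    n∸1≤deg : n ∸ 1 ≤ deg G v
    n∸1≤deg = subst (_≤ deg G v) (∣∁⁅v⁆∣≡n∸1 v) (p⊆q⇒∣p∣≤∣q∣ ∁⁅v⁆⊆N)

  isTotal12Set⇒is12Set : ∀ {S} → IsTotal12Set G S → Is12Set G S
  isTotal12Set⇒is12Set total v _ = total v

  is12Set⇒isDominating : ∀ {S} → Is12Set G S → IsDominating G S
  is12Set⇒isDominating [1,2] v v∉S = proj₁ ([1,2] v v∉S)

  isTotal12Set⇒2≤∣S∣ : Fin n → ∀ S → IsTotal12Set G S → 2 ≤ ∣ S ∣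
  isTotal12Set⇒2≤∣S∣ v S total with 1≤∣N∩S∣⇒neighbourIn (proj₁ (total v))
  ... | s , _ , s∈S with 1≤∣N∩S∣⇒neighbourIn (proj₁ (total s))
  ... | t , s~t , t∈S = x≢y∈p⇒2≤∣p∣ s∈S t∈S (~⇒≢ s~t)

  isDominating⇒2≤∣S∣ : (∀ v → ∃ λ u → u ≢ v × v ≁ u) → Fin n → ∀ S → IsDominating G S → 2 ≤ ∣ S ∣
  isDominating⇒2≤∣S∣ nonNeighbour v S dominating = go member
    where
    member : ∃ λ s → s ∈ S
    member with v ∈? S
    ... | yes v∈S = v , v∈S
    ... | no v∉S = let s , _ , s∈S = 1≤∣N∩S∣⇒neighbourIn (dominating v v∉S) in s , s∈S
    go : (∃ λ s → s ∈ S) → 2 ≤ ∣ S ∣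
    go (s , s∈S) with nonNeighbour s
    ... | u , u≢s , s≁u with u ∈? S
    ... | yes u∈S = x≢y∈p⇒2≤∣p∣ u∈S s∈S u≢s
    ... | no u∉S with 1≤∣N∩S∣⇒neighbourIn (dominating u u∉S)
    ... | t , u~t , t∈S = x≢y∈p⇒2≤∣p∣ t∈S s∈S t≢s
      where
      t≢s : t ≢ s
      t≢s refl = ~⇒≁⇒⊥ (~-sym u~t) s≁u

  coveringPair⇒isTotal12Set : ∀ {a b} → a ≢ b → (∀ u → u ~ a ⊎ u ~ b) → IsTotal12Set G (⁅ a ⁆ ∪ ⁅ b ⁆)
  coveringPair⇒isTotal12Set {a} {b} a≢b cover v =
    [ hit (inj₁ (x∈⁅x⁆ a)) , hit (inj₂ (x∈⁅x⁆ b)) ]′ (cover v) ,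
    ≤-trans (∣p∩q∣≤∣q∣ (N G v) _) (≤-reflexive (∣⁅x⁆∪⁅y⁆∣≡2 a≢b))
    where
    hit : ∀ {u} → u ∈ ⁅ a ⁆ ⊎ u ∈ ⁅ b ⁆ → v ~ u → 1 ≤ ∣ N G v ∩ (⁅ a ⁆ ∪ ⁅ b ⁆) ∣
    hit u∈ v~u = x∈p⇒1≤∣p∣ (x∈p∩q⁺ (~⇒∈N v~u , x∈p∪q⁺ u∈))

  universal⇒coveringPair : ∀ {v w} → (∀ u → u ≢ v → v ~ u) → w ≢ v → ∀ u → u ~ w ⊎ u ~ v
  universal⇒coveringPair {v} universal w≢v u with u ≟ᶠ v
  ... | yes refl = inj₁ (universal _ w≢v)
  ... | no u≢v   = inj₂ (~-sym (universal u u≢v))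

  reach⇒neighbour : ∀ {u v} → Reach G u v → u ≢ v → ∃ λ w → u ~ w
  reach⇒neighbour here          u≢u = contradiction refl u≢u
  reach⇒neighbour (step u~w _) _   = _ , u~w

  module _ (p4Free : P4Free G) where

    noInducedP4 : ∀ {a b c d} → a ~ b → b ~ c → c ~ d → a ≁ c → b ≁ d → a ≁ d → ⊥
    noInducedP4 {a} {b} {c} {d} a~b b~c c~d a≁c b≁d a≁d =
      p4Free a b c d (~⇒≢ a~b , a≢c , a≢d , ~⇒≢ b~c , b≢d , ~⇒≢ c~d , a~b , b~c , c~d , a≁c , b≁d , a≁d)
      where
      a≢c : a ≢ c
      a≢c refl = ~⇒≁⇒⊥ c~d a≁d
      a≢d : a ≢ d
      a≢d refl = ~⇒≁⇒⊥ (~-sym c~d) a≁c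
      b≢d : b ≢ d
      b≢d refl = ~⇒≁⇒⊥ a~b a≁d

    N_∖N_ : Fin n → Fin n → Subset n
    N b ∖N a = N G b ∩ ∁ (N G a)

    ∖N-grows : ∀ {a b z y′} → a ~ b → a ~ z → z ~ y′ → a ≁ y′ → b ≁ y′ → N b ∖N a ⊂ N z ∖N a
    ∖N-grows {a} {b} {z} {y′} a~b a~z z~y′ a≁y′ b≁y′ = ⊆ , y′ , y′∈Nz∖Na , y′∉Nb∖Na
      where
      y′∈Nz∖Na : y′ ∈ N z ∖N a
      y′∈Nz∖Na = x∈p∩q⁺ (~⇒∈N z~y′ , x∉p⇒x∈∁p λ y′∈N → ~⇒≁⇒⊥ (∈N⇒~ y′∈N) a≁y′)
      y′∉Nb∖Na : y′ ∉ N b ∖N a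
      y′∉Nb∖Na y′∈ = ~⇒≁⇒⊥ (∈N⇒~ (proj₁ (x∈p∩q⁻ _ _ y′∈))) b≁y′
      y′≁x : ∀ {x} → b ~ x → a ≁ x → y′ ≁ x
      y′≁x {x} b~x a≁x with ~-or-≁ y′ x
      ... | inj₂ y′≁x = y′≁x
      ... | inj₁ y′~x = ⊥-elim (noInducedP4 y′~x (~-sym b~x) (~-sym a~b) (≁-sym b≁y′) (≁-sym a≁x) (≁-sym a≁y′))
      z~x : ∀ {x} → b ~ x → a ≁ x → z ~ x
      z~x {x} b~x a≁x with ~-or-≁ z x | ~-or-≁ z b
      ... | inj₁ z~x | _         = z~x
      ... | inj₂ z≁x | inj₁ z~b = ⊥-elim (noInducedP4 (~-sym z~y′) z~b b~x (≁-sym b≁y′) z≁x (y′≁x b~x a≁x))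
      ... | inj₂ z≁x | inj₂ z≁b = ⊥-elim (noInducedP4 (~-sym b~x) (~-sym a~b) a~z (≁-sym a≁x) (≁-sym z≁b) (≁-sym z≁x))
      ⊆ : N b ∖N a ⊆ N z ∖N a
      ⊆ x∈ with x∈p∩q⁻ _ _ x∈
      ... | x∈Nb , x∈∁Na = x∈p∩q⁺ (~⇒∈N (z~x (∈N⇒~ x∈Nb) (∉N⇒≁ (x∈∁p⇒x∉p x∈∁Na))) , x∈∁Na)

    undominated⇒escape : ∀ {a b y} → a ~ b → Reach G y a → a ≁ y → b ≁ y →
      ∃₂ λ z y′ → a ~ z × z ~ y′ × a ≁ y′ × b ≁ y′
    undominated⇒escape a~b here _ b≁a = ⊥-elim (~⇒≁⇒⊥ a~b (≁-sym b≁a))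
    undominated⇒escape {a} {b} {y} a~b (step {w = w} y~w w⇝a) a≁y b≁y with ~-or-≁ a w | ~-or-≁ b w
    ... | inj₁ a~w | _        = w , y , a~w , ~-sym y~w , a≁y , b≁y
    ... | inj₂ a≁w | inj₁ b~w = ⊥-elim (noInducedP4 y~w (~-sym b~w) (~-sym a~b) (≁-sym b≁y) (≁-sym a≁w) (≁-sym a≁y))
    ... | inj₂ a≁w | inj₂ b≁w = undominated⇒escape a~b w⇝a a≁w b≁w

    module _ (connected : Connected G) where

      dominatingNeighbour : ∀ {a b} → a ~ b → Acc _<_ (n ∸ ∣ N b ∖N a ∣) →
        ∃ λ c → a ~ c × ∀ u → u ~ a ⊎ u ~ c
      dominatingNeighbour {a} {b} a~b (acc rec) with any? (λ y → ≁? a y ×-dec ≁? b y)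
      ... | no noneUndominated = b , a~b , cover
        where
        cover : ∀ u → u ~ a ⊎ u ~ b
        cover u with ~-or-≁ a u | ~-or-≁ b u
        ... | inj₁ a~u | _        = inj₁ (~-sym a~u)
        ... | inj₂ _   | inj₁ b~u = inj₂ (~-sym b~u)
        ... | inj₂ a≁u | inj₂ b≁u = contradiction (u , a≁u , b≁u) noneUndominated
      ... | yes (y , a≁y , b≁y) with undominated⇒escape a~b (connected y a) a≁y b≁y
      ... | z , y′ , a~z , z~y′ , a≁y′ , b≁y′ =
        dominatingNeighbour a~z (rec (∸-monoʳ-< (p⊂q⇒∣p∣<∣q∣ (∖N-grows a~b a~z z~y′ a≁y′ b≁y′)) (∣p∣≤n (N z ∖N a))))

      dominatingEdge : (a w : Fin n) → w ≢ a → ∃ λ b → a ~ b × ∀ u → u ~ a ⊎ u ~ b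
      dominatingEdge a w w≢a with reach⇒neighbour (connected a w) (λ a≡w → w≢a (≡.sym a≡w))
      ... | b , a~b = dominatingNeighbour a~b (<-wellFounded _)

theorem4p5 : (n : ℕ) → 4 ≤ n → (G : Graph n) → Connected G → P4Free G →
    (Δ G ≡ n ∸ 1 → γt[1,2]≡ G 2) ×
    (Δ G < n ∸ 1 → Σ ℕ λ k → γ≡ G k × γ[1,2]≡ G k × γt[1,2]≡ G k)
theorem4p5 (suc (suc m)) (s≤s (s≤s _)) G connected p4Free = universalCase , noUniversalCase
  where
  open GraphProperties G

  pairSet : ∀ {a b} → a ≢ b → (∀ u → u ~ a ⊎ u ~ b) →
    Σ (Subset (suc (suc m))) λ S → IsTotal12Set G S × ∣ S ∣ ≡ 2
  pairSet {a} {b} a≢b cover = ⁅ a ⁆ ∪ ⁅ b ⁆ , coveringPair⇒isTotal12Set a≢b cover , ∣⁅x⁆∪⁅y⁆∣≡2 a≢b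

  universalCase : Δ G ≡ suc m → γt[1,2]≡ G 2
  universalCase Δ≡n∸1 with Δ-attained (subst (1 ≤_) (≡.sym Δ≡n∸1) (s≤s z≤n))
  ... | v , deg≡Δ = MinSizeIs-sandwich id id
    (pairSet w≢v (universal⇒coveringPair (deg≡n∸1⇒universal (trans deg≡Δ Δ≡n∸1)) w≢v))
    (isTotal12Set⇒2≤∣S∣ v)
    where
    w≢v : punchIn v zero ≢ v
    w≢v = punchInᵢ≢i v zero

  noUniversalCase : Δ G < suc m → Σ ℕ λ k → γ≡ G k × γ[1,2]≡ G k × γt[1,2]≡ G k
  noUniversalCase Δ<n∸1 with dominatingEdge p4Free connected zero (suc zero) (λ ())
  ... | b , 0~b , cover =
    2 , sandwich total⇒dominating id , sandwich isTotal12Set⇒is12Set is12Set⇒isDominating ,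
    sandwich id total⇒dominating
    where
    total⇒dominating : ∀ {S} → IsTotal12Set G S → IsDominating G S
    total⇒dominating = is12Set⇒isDominating ∘ isTotal12Set⇒is12Set
    sandwich : ∀ {P} → (∀ {S} → IsTotal12Set G S → P S) → (∀ {S} → P S → IsDominating G S) →
      MinSizeIs P 2
    sandwich total⇒P P⇒dominating = MinSizeIs-sandwich total⇒P P⇒dominating
      (pairSet (~⇒≢ 0~b) cover) (isDominating⇒2≤∣S∣ (Δ<n∸1⇒nonNeighbour Δ<n∸1) zero)
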